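{- For any directed star $G$ of order $n\geq 2$, we have $\gamma_L(G)=n-1$.
   Context: A directed star is a digraph with a special vertex that belongs to all arcs and with no isolated vertices (its underlying undirected graph is a star). A dominating set of a digraph $G$ is a set $D$ such that every vertex not in $D$ has an in-neighbour in $D$; it is locating-dominating if moreover every vertex not in $D$ has a distinct set of in-neighbours in $D$. $\gamma_L(G)$ denotes the minimum size of a locating-dominating set of $G$. -}

module Defs where

open import Data.Nat using (ℕ; _≤_)
open import Data.Bool using (Bool; true; false)
open import Data.Fin using (Fin)
open import Data.Fin.Subset using (Subset; _∈_; _∉_; ∣_∣)
open import Data.Product using (Σ; ∃; ∃-syntax; _×_)
open import Data.Sum using (_⊎_)
open import Relation.Binary.PropositionalEquality using (_≡_; _≢_)

record Digraph (n : ℕ) : Set where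
  field
    arc      : Fin n → Fin n → Bool
    loopless : ∀ v → arc v v ≡ false
open Digraph public

_⟶[_]_ : ∀ {n} → Fin n → Digraph n → Fin n → Set
u ⟶[ G ] v = arc G u v ≡ true

IsDirectedStar : ∀ {n} → Digraph n → Set
IsDirectedStar {n} G =
  Σ (Fin n) λ c →
    (∀ u v → u ⟶[ G ] v → (u ≡ c ⊎ v ≡ c)) ×
    (∀ v → ∃[ u ] (u ⟶[ G ] v ⊎ v ⟶[ G ] u))

IsDominating : ∀ {n} → Digraph n → Subset n → Set
IsDominating {n} G D = ∀ (v : Fin n) → v ∉ D → ∃[ u ] (u ∈ D × u ⟶[ G ] v)

IsLocatingDominating : ∀ {n} → Digraph n → Subset n → Set
IsLocatingDominating {n} G D =
  IsDominating G D ×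
  (∀ (u v : Fin n) → u ∉ D → v ∉ D → u ≢ v →
     ∃[ w ] (w ∈ D × arc G w u ≢ arc G w v))

γL≡ : ∀ {n} → Digraph n → ℕ → Set
γL≡ {n} G k =
  (∃[ D ] (IsLocatingDominating G D × ∣ D ∣ ≡ k)) ×
  (∀ (D : Subset n) → IsLocatingDominating G D → k ≤ ∣ D ∣)

-- Every arc of a star touches its centre c, so a vertex v ≠ c has c as its only possible
-- in-neighbour. Two vertices outside a dominating set D are therefore both leaves
-- dominated by c, with identical in-neighbourhoods {c}; a locating-dominating set thus
-- misses at most one vertex. Conversely, removing the head of any arc leaves a
-- locating-dominating set, and a digraph without isolated vertices has an arc.
module Submission where

open import Defs
open import Data.Nat using (ℕ; _≤_; _∸_; suc; z≤n; s≤s)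
open import Data.Nat.Properties using (≤-trans; m≤n+m∸n; +-monoʳ-≤; +-comm; m≤n+o⇒m∸n≤o)
open import Data.Bool using (true; false)
open import Data.Fin using (Fin; zero; _≟_)
open import Data.Fin.Subset using (Subset; _∈_; _∉_; ∣_∣; ∁; ⁅_⁆; _⊆_)
open import Data.Fin.Subset.Properties
  using ( nonempty?; Empty-unique; ∣⊥∣≡0; ∣⁅x⁆∣≡1; x∈⁅x⁆; x∈⁅y⁆⇒x≡y; p⊆q⇒∣p∣≤∣q∣
        ; ∣∁p∣≡n∸∣p∣; x∈∁p⇒x∉p; x∉p⇒x∈∁p; x∉∁p⇒x∈p )
open import Data.Product using (∃-syntax; _×_; _,_)
open import Data.Sum using (_⊎_; inj₁; inj₂)
open import Data.Empty using (⊥-elim)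
open import Function using (_∘_)
open import Relation.Nullary using (yes; no)
open import Relation.Binary.PropositionalEquality

m∸n≤1⇒m∸1≤n : ∀ m n → m ∸ n ≤ 1 → m ∸ 1 ≤ n
m∸n≤1⇒m∸1≤n m n m∸n≤1 =
  m≤n+o⇒m∸n≤o m 1 (subst (m ≤_) (+-comm n 1) (≤-trans (m≤n+m∸n m n) (+-monoʳ-≤ n m∸n≤1)))

∣∁p∣≤1 : ∀ {n} (p : Subset n) → (∀ {u v} → u ∉ p → v ∉ p → u ≡ v) → ∣ ∁ p ∣ ≤ 1
∣∁p∣≤1 {n} p outside-unique with nonempty? (∁ p)
... | yes (v , v∈∁p) = subst (∣ ∁ p ∣ ≤_) (∣⁅x⁆∣≡1 v) (p⊆q⇒∣p∣≤∣q∣ ∁p⊆⁅v⁆)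
  where
  ∁p⊆⁅v⁆ : ∁ p ⊆ ⁅ v ⁆
  ∁p⊆⁅v⁆ {u} u∈∁p =
    subst (_∈ ⁅ v ⁆) (outside-unique (x∈∁p⇒x∉p v∈∁p) (x∈∁p⇒x∉p u∈∁p)) (x∈⁅x⁆ v)
... | no ∁p-empty rewrite Empty-unique ∁p-empty | ∣⊥∣≡0 n = z≤n

∁-subsingleton⇒n∸1≤∣p∣ : ∀ {n} (p : Subset n) →
                         (∀ {u v} → u ∉ p → v ∉ p → u ≡ v) → n ∸ 1 ≤ ∣ p ∣
∁-subsingleton⇒n∸1≤∣p∣ {n} p outside-unique =
  m∸n≤1⇒m∸1≤n n ∣ p ∣ (subst (_≤ 1) (∣∁p∣≡n∸∣p∣ p) (∣∁p∣≤1 p outside-unique))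

module _ {n : ℕ} (G : Digraph n) where

  ⟶-irreflexive : ∀ {u v} → u ⟶[ G ] v → u ≢ v
  ⟶-irreflexive {u} u⟶u refl with trans (sym u⟶u) (loopless G u)
  ... | ()

  ∁⁅head⁆-locatingDominating : ∀ {u v} → u ⟶[ G ] v → IsLocatingDominating G (∁ ⁅ v ⁆)
  ∁⁅head⁆-locatingDominating {u} {v} u⟶v = dominating , λ x y x∉ y∉ x≢y →
    ⊥-elim (x≢y (trans (is-v x∉) (sym (is-v y∉))))
    where
    is-v : ∀ {x} → x ∉ ∁ ⁅ v ⁆ → x ≡ v
    is-v x∉ = x∈⁅y⁆⇒x≡y v (x∉∁p⇒x∈p x∉)
    dominating : IsDominating G (∁ ⁅ v ⁆)
    dominating x x∉ rewrite is-v x∉ =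
      u , x∉p⇒x∈∁p (λ u∈⁅v⁆ → ⟶-irreflexive u⟶v (x∈⁅y⁆⇒x≡y v u∈⁅v⁆)) , u⟶v

  locatingDominating-of-size-n∸1 : ∀ {u v} → u ⟶[ G ] v →
                                   ∃[ D ] (IsLocatingDominating G D × ∣ D ∣ ≡ n ∸ 1)
  locatingDominating-of-size-n∸1 {v = v} u⟶v =
    ∁ ⁅ v ⁆ , ∁⁅head⁆-locatingDominating u⟶v , trans (∣∁p∣≡n∸∣p∣ ⁅ v ⁆) (cong (n ∸_) (∣⁅x⁆∣≡1 v))

  no-isolated⇒arc : (∀ v → ∃[ u ] (u ⟶[ G ] v ⊎ v ⟶[ G ] u)) → Fin n → ∃[ u ] ∃[ v ] u ⟶[ G ] v
  no-isolated⇒arc no-isolated v with no-isolated v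
  ... | u , inj₁ u⟶v = u , v , u⟶v
  ... | u , inj₂ v⟶u = v , u , v⟶u

  module Star (c : Fin n) (star : ∀ u v → u ⟶[ G ] v → u ≡ c ⊎ v ≡ c) where

    ⟶-leaf⇒from-centre : ∀ {u v} → u ⟶[ G ] v → v ≢ c → u ≡ c
    ⟶-leaf⇒from-centre {u} {v} u⟶v v≢c with star u v u⟶v
    ... | inj₁ u≡c = u≡c
    ... | inj₂ v≡c = ⊥-elim (v≢c v≡c)

    arc-between-leaves : ∀ {u v} → u ≢ c → v ≢ c → arc G u v ≡ false
    arc-between-leaves {u} {v} u≢c v≢c with arc G u v in u⟶v
    ... | false = refl
    ... | true  = ⊥-elim (u≢c (⟶-leaf⇒from-centre u⟶v v≢c))

    module _ {D : Subset n} (dominating : IsDominating G D) where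

      centre∉D⇒outside≡centre : ∀ {v} → c ∉ D → v ∉ D → v ≡ c
      centre∉D⇒outside≡centre {v} c∉D v∉D with dominating v v∉D
      ... | w , w∈D , w⟶v with star w v w⟶v
      ... | inj₁ refl = ⊥-elim (c∉D w∈D)
      ... | inj₂ v≡c  = v≡c

      leaf-dominated-by-centre : ∀ {v} → v ∉ D → v ≢ c → c ⟶[ G ] v
      leaf-dominated-by-centre {v} v∉D v≢c with dominating v v∉D
      ... | w , _ , w⟶v = subst (_⟶[ G ] v) (⟶-leaf⇒from-centre w⟶v v≢c) w⟶v

      outside-pair-are-leaves : ∀ {u v} → u ∉ D → v ∉ D → u ≢ v → u ≢ c
      outside-pair-are-leaves {u} u∉D v∉D u≢v refl =
        u≢v (sym (centre∉D⇒outside≡centre u∉D v∉D))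

      outside-leaves-same-in-arcs : ∀ {u v} → u ∉ D → v ∉ D → u ≢ c → v ≢ c →
                                    ∀ w → arc G w u ≡ arc G w v
      outside-leaves-same-in-arcs u∉D v∉D u≢c v≢c w with w ≟ c
      ... | yes refl = trans (leaf-dominated-by-centre u∉D u≢c)
                             (sym (leaf-dominated-by-centre v∉D v≢c))
      ... | no w≢c   = trans (arc-between-leaves w≢c u≢c) (sym (arc-between-leaves w≢c v≢c))

    locatingDominating-misses-≤1 : ∀ {D} → IsLocatingDominating G D →
                                   ∀ {u v} → u ∉ D → v ∉ D → u ≡ v
    locatingDominating-misses-≤1 (dominating , locating) {u} {v} u∉D v∉D with u ≟ v
    ... | yes u≡v = u≡v
    ... | no u≢v with locating u v u∉D v∉D u≢v
    ... | w , _ , separates = ⊥-elim (separates (outside-leaves-same-in-arcs dominating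
            u∉D v∉D (outside-pair-are-leaves dominating u∉D v∉D u≢v)
            (outside-pair-are-leaves dominating v∉D u∉D (u≢v ∘ sym)) w))

proposition5 : (n : ℕ) → 2 ≤ n → (G : Digraph n) → IsDirectedStar G → γL≡ G (n ∸ 1)
proposition5 n@(suc _) (s≤s _) G (c , star , no-isolated) = upper , lower
  where
  open Star G c star
  upper : ∃[ D ] (IsLocatingDominating G D × ∣ D ∣ ≡ n ∸ 1)
  upper with no-isolated⇒arc G no-isolated zero
  ... | _ , _ , u⟶v = locatingDominating-of-size-n∸1 G u⟶v
  lower : ∀ D → IsLocatingDominating G D → n ∸ 1 ≤ ∣ D ∣
  lower D ld = ∁-subsingleton⇒n∸1≤∣p∣ D (locatingDominating-misses-≤1 ld)
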